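{- Let $m \ge 3$, $r\ge 1$ be integers with $2r \le \lceil m/2\rceil$. Then $\operatorname{Z}(Wb(m,r)) \le \lceil m/2\rceil$.
   Context: The web graph $Wb(m,r)$ is obtained from the Cartesian product $C_m \Box P_r$, with vertices $v_{i,j}$ ($i\in[m]$, $j\in[r]$), where $v_{i,j_1}\sim v_{i,j_2}$ iff $|j_1-j_2|=1$ and $v_{i_1,j}\sim v_{i_2,j}$ iff $|i_1-i_2|=1$ or $\{i_1,i_2\}=\{1,m\}$, by adding pendant vertices $p_1,\dots,p_m$ with $p_i$ adjacent only to $v_{i,1}$. Zero forcing: a blue vertex with exactly one white neighbor may color that neighbor blue; a zero forcing set is an initial blue set from which repeated application colors all vertices blue; $\operatorname{Z}(G)$ is the minimum size of a zero forcing set. -}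

module Defs where

open import Data.Nat using (ℕ; zero; suc; _+_; _≤_; _<_; ⌈_/2⌉)
open import Data.Fin using (Fin; toℕ)
open import Data.List using (List; length)
open import Data.List.Membership.Propositional using (_∈_)
open import Data.List.Relation.Unary.Unique.Propositional using (Unique)
open import Data.Product using (Σ; _×_; ∃)
open import Data.Sum using (_⊎_)
open import Relation.Binary.PropositionalEquality using (_≡_; _≢_)
open import Level using (0ℓ)

record Graph : Set₁ where
  field
    V    : Set
    _~_  : V → V → Set

open Graph public

-- This inductive closure is
-- exactly the final coloring of the zero forcing process (the rule is
-- monotone, so the final set does not depend on the order of forces).

data Blue (G : Graph) (S : List (V G)) : V G → Set where
  initial : ∀ {v} → v ∈ S → Blue G S v
  force   : ∀ {u v} → Blue G S u → _~_ G u v →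
            (∀ w → _~_ G u w → w ≢ v → Blue G S w) →
            Blue G S v

IsZeroForcingSet : (G : Graph) → List (V G) → Set
IsZeroForcingSet G S = Unique S × (∀ v → Blue G S v)

-- Z(G) ≤ k : the minimum size of a zero forcing set is at most k,
-- i.e. some zero forcing set has at most k elements.
Z≤ : Graph → ℕ → Set
Z≤ G k = Σ (List (V G)) λ S → IsZeroForcingSet G S × length S ≤ k

-- The web graph Wb(m,r).  Indices are 0-based: cyc i j is v_{i+1,j+1},
-- pend i is p_{i+1}.

data WbV (m r : ℕ) : Set where
  cyc  : Fin m → Fin r → WbV m r
  pend : Fin m → WbV m r

CycAdj : (m : ℕ) → Fin m → Fin m → Set
CycAdj m i₁ i₂ =
  (suc (toℕ i₁) ≡ toℕ i₂) ⊎ (suc (toℕ i₂) ≡ toℕ i₁) ⊎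
  ((toℕ i₁ ≡ 0 × suc (toℕ i₂) ≡ m) ⊎ (toℕ i₂ ≡ 0 × suc (toℕ i₁) ≡ m))

PathAdj : (r : ℕ) → Fin r → Fin r → Set
PathAdj r j₁ j₂ = (suc (toℕ j₁) ≡ toℕ j₂) ⊎ (suc (toℕ j₂) ≡ toℕ j₁)

data WbAdj (m r : ℕ) : WbV m r → WbV m r → Set where
  path-edge  : ∀ i j₁ j₂ → PathAdj r j₁ j₂ → WbAdj m r (cyc i j₁) (cyc i j₂)
  cycle-edge : ∀ i₁ i₂ j → CycAdj m i₁ i₂ → WbAdj m r (cyc i₁ j) (cyc i₂ j)
  pend-out   : ∀ i (j : Fin r) → toℕ j ≡ 0 → WbAdj m r (pend i) (cyc i j)
  pend-in    : ∀ i (j : Fin r) → toℕ j ≡ 0 → WbAdj m r (cyc i j) (pend i)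

Wb : ℕ → ℕ → Graph
Wb m r = record { V = WbV m r ; _~_ = WbAdj m r }

-- The seed is the set of pendants of 2r consecutive columns together with the pendants of every
-- second column for A = ⌈m/2⌉ − 2r further steps; the remaining gap of at most 2r columns carries
-- none.  The 2r seeded pendants force a triangle which fills the two middle columns of the block.
-- Two adjacent full columns force all cycle vertices of the next column, and its pendant too once
-- the pendant after it is seeded, so fullness spreads over the block and the alternating part.
-- From the two full borders of the gap, staircases (the column x steps inside is blue from height
-- x upwards) run into it and meet below the top row, because the gap has at most 2r columns.
-- Once the top row is blue, every vertex v_{i,j+1} forces v_{i,j}, and finally the pendants are
-- forced, row by row downwards.

module Submission where

open import Defs
open import Data.Nat using (ℕ; zero; suc; _+_; _*_; _∸_; _≤_; _<_; ⌈_/2⌉; z≤n; s≤s; _<?_; _≤?_)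
open import Data.Nat.Properties
open import Data.Fin using (Fin; toℕ; fromℕ<) renaming (zero to fzero)
open import Data.Fin.Properties using (toℕ-fromℕ<; toℕ-injective; toℕ<n) renaming (_≟_ to _≟ᶠ_)
open import Data.List using (List; length; deduplicate; applyUpTo; _++_)
open import Data.List.Membership.Propositional using (_∈_)
open import Data.List.Membership.Propositional.Properties
  using (∈-deduplicate⁺; ∈-applyUpTo⁺; ∈-++⁺ˡ; ∈-++⁺ʳ)
open import Data.List.Properties using (length-deduplicate; length-applyUpTo; length-++)
open import Data.List.Relation.Unary.Unique.DecPropositional.Properties using (deduplicate-!)
open import Data.Product using (_×_; _,_; proj₁; proj₂; ∃-syntax)
open import Data.Sum using (_⊎_; inj₁; inj₂)
open import Data.Empty using (⊥-elim)
open import Function using (_∘_)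
open import Relation.Binary.Definitions using (DecidableEquality)
open import Relation.Binary.PropositionalEquality
open import Relation.Nullary using (yes; no)
open import Relation.Nullary.Decidable using (map′; _×-dec_)
open import Data.Nat.Tactic.RingSolver using (solve-∀)

module _ {G : Graph} where

  blue-mono : ∀ {S S′ v} → (∀ {x} → x ∈ S → x ∈ S′) → Blue G S v → Blue G S′ v
  blue-mono S⊆S′ (initial v∈S)      = initial (S⊆S′ v∈S)
  blue-mono S⊆S′ (force u u~v rest) =
    force (blue-mono S⊆S′ u) u~v (λ w u~w w≢v → blue-mono S⊆S′ (rest w u~w w≢v))

  Z≤-from-forcing-list : DecidableEquality (V G) → ∀ {S k} →
    (∀ v → Blue G S v) → length S ≤ k → Z≤ G k
  Z≤-from-forcing-list _≟_ {S} all-blue len≤k =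
    deduplicate _≟_ S ,
    (deduplicate-! _≟_ S , λ v → blue-mono (∈-deduplicate⁺ _≟_) (all-blue v)) ,
    ≤-trans (length-deduplicate _≟_ S) len≤k

_≟ᵂ_ : ∀ {m r} → DecidableEquality (WbV m r)
cyc i j ≟ᵂ cyc i′ j′ =
  map′ (λ (p , q) → cong₂ cyc p q) (λ { refl → refl , refl }) ((i ≟ᶠ i′) ×-dec (j ≟ᶠ j′))
cyc _ _ ≟ᵂ pend _    = no λ ()
pend _ ≟ᵂ cyc _ _    = no λ ()
pend i ≟ᵂ pend i′    = map′ (cong pend) (λ { refl → refl }) (i ≟ᶠ i′)

module CyclicSuccessor (n : ℕ) where

  csuc : Fin (suc n) → Fin (suc n)
  csuc i with suc (toℕ i) <? suc n
  ... | yes i+1<m = fromℕ< i+1<m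
  ... | no _      = fzero

  toℕ-csuc : ∀ {i} → suc (toℕ i) < suc n → toℕ (csuc i) ≡ suc (toℕ i)
  toℕ-csuc {i} i+1<m with suc (toℕ i) <? suc n
  ... | yes i+1<m′ = toℕ-fromℕ< i+1<m′
  ... | no  i+1≮m  = ⊥-elim (i+1≮m i+1<m)

  csuc-last : ∀ {i} → suc (toℕ i) ≡ suc n → csuc i ≡ fzero
  csuc-last {i} i+1≡m with suc (toℕ i) <? suc n
  ... | yes i+1<m = ⊥-elim (<-irrefl i+1≡m i+1<m)
  ... | no _      = refl

  last-or-not : ∀ i → suc (toℕ i) < suc n ⊎ suc (toℕ i) ≡ suc n
  last-or-not i = m≤n⇒m<n∨m≡n (toℕ<n i)

  csuc-injective : ∀ {i j} → csuc i ≡ csuc j → i ≡ j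
  csuc-injective {i} {j} eq with last-or-not i | last-or-not j
  ... | inj₁ i<  | inj₁ j<  =
    toℕ-injective (suc-injective (trans (sym (toℕ-csuc i<)) (trans (cong toℕ eq) (toℕ-csuc j<))))
  ... | inj₁ i<  | inj₂ j≡  =
    ⊥-elim (1+n≢0 (trans (sym (toℕ-csuc i<)) (cong toℕ (trans eq (csuc-last j≡)))))
  ... | inj₂ i≡  | inj₁ j<  =
    ⊥-elim (1+n≢0 (trans (sym (toℕ-csuc j<)) (cong toℕ (trans (sym eq) (csuc-last i≡)))))
  ... | inj₂ i≡  | inj₂ j≡  = toℕ-injective (suc-injective (trans i≡ (sym j≡)))

  cycAdj-sym : ∀ {i j} → CycAdj (suc n) i j → CycAdj (suc n) j i
  cycAdj-sym (inj₁ e)                = inj₂ (inj₁ e)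
  cycAdj-sym (inj₂ (inj₁ e))         = inj₁ e
  cycAdj-sym (inj₂ (inj₂ (inj₁ e)))  = inj₂ (inj₂ (inj₂ e))
  cycAdj-sym (inj₂ (inj₂ (inj₂ e)))  = inj₂ (inj₂ (inj₁ e))

  cycAdj-csuc : ∀ i → CycAdj (suc n) i (csuc i)
  cycAdj-csuc i with last-or-not i
  ... | inj₁ i+1<m = inj₁ (sym (toℕ-csuc i+1<m))
  ... | inj₂ i+1≡m = inj₂ (inj₂ (inj₂ (cong toℕ (csuc-last i+1≡m) , i+1≡m)))

  cycAdj⇒csuc : ∀ {i j} → CycAdj (suc n) i j → j ≡ csuc i ⊎ i ≡ csuc j
  cycAdj⇒csuc {i} {j} (inj₁ e) =
    inj₁ (toℕ-injective (trans (sym e) (sym (toℕ-csuc (subst (_< suc n) (sym e) (toℕ<n j))))))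
  cycAdj⇒csuc {i} {j} (inj₂ (inj₁ e)) =
    inj₂ (toℕ-injective (trans (sym e) (sym (toℕ-csuc (subst (_< suc n) (sym e) (toℕ<n i))))))
  cycAdj⇒csuc (inj₂ (inj₂ (inj₁ (i≡0 , j+1≡m)))) =
    inj₂ (trans (toℕ-injective i≡0) (sym (csuc-last j+1≡m)))
  cycAdj⇒csuc (inj₂ (inj₂ (inj₂ (j≡0 , i+1≡m)))) =
    inj₁ (trans (toℕ-injective j≡0) (sym (csuc-last i+1≡m)))

  col : ℕ → Fin (suc n)
  col zero    = fzero
  col (suc a) = csuc (col a)

  toℕ-col : ∀ {a} → a < suc n → toℕ (col a) ≡ a
  toℕ-col {zero}  _     = refl
  toℕ-col {suc a} a+1<m =
    trans (toℕ-csuc (subst (λ t → suc t < suc n) (sym ih) a+1<m)) (cong suc ih)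
    where ih = toℕ-col (<-trans (n<1+n a) a+1<m)

  col-toℕ : ∀ i → col (toℕ i) ≡ i
  col-toℕ i = toℕ-injective (toℕ-col (toℕ<n i))

  col-periodic : ∀ a → col (a + suc n) ≡ col a
  col-periodic zero    = csuc-last (cong suc (toℕ-col (n<1+n n)))
  col-periodic (suc a) = cong csuc (col-periodic a)

  cycAdj-col⁻ : ∀ {a i} → CycAdj (suc n) (col (suc a)) i → i ≡ col a ⊎ i ≡ col (suc (suc a))
  cycAdj-col⁻ adj with cycAdj⇒csuc adj
  ... | inj₁ i≡next = inj₂ i≡next
  ... | inj₂ same   = inj₁ (sym (csuc-injective same))

module Forcing (n r₀ : ℕ) (S : List (WbV (suc n) (suc r₀))) where

  open CyclicSuccessor n

  r : ℕ
  r = suc r₀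

  IsBlue : WbV (suc n) (suc r₀) → Set
  IsBlue = Blue (Wb (suc n) (suc r₀)) S

  -- Position (a , 0) is the pendant p_a and (a , suc k) is the cycle vertex v_{a,k}
  -- (0-based), with the column a read modulo m through col.
  data _IsAt_ : WbV (suc n) (suc r₀) → ℕ × ℕ → Set where
    at-pend : ∀ {a} → pend (col a) IsAt (a , 0)
    at-cyc  : ∀ {a k} j → toℕ j ≡ k → cyc (col a) j IsAt (a , suc k)

  BlueAt : ℕ × ℕ → Set
  BlueAt p = ∀ {w} → w IsAt p → IsBlue w

  isAt-unique : ∀ {v w p} → v IsAt p → w IsAt p → v ≡ w
  isAt-unique at-pend       at-pend       = refl
  isAt-unique (at-cyc i i≡k) (at-cyc j j≡k) = cong (cyc _) (toℕ-injective (trans i≡k (sym j≡k)))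

  level<r : ∀ {w a k} → w IsAt (a , suc k) → k < r
  level<r (at-cyc j refl) = toℕ<n j

  blueAt-beyond : ∀ {a k} → r < k → BlueAt (a , k)
  blueAt-beyond (s≤s r≤k) w-at = ⊥-elim (<⇒≱ (level<r w-at) r≤k)

  blueAt-cong : ∀ {a b k} → col a ≡ col b → BlueAt (a , k) → BlueAt (b , k)
  blueAt-cong {a} eq blue at-pend        = blue (subst (λ c → pend c IsAt (a , 0)) eq at-pend)
  blueAt-cong {a} eq blue (at-cyc j j≡k) =
    blue (subst (λ c → cyc c j IsAt (a , _)) eq (at-cyc j j≡k))

  data Dir : Set where
    up down left right : Dir

  neighbour : Dir → ℕ → ℕ → ℕ × ℕ
  neighbour up    a k = suc a , suc (suc k)
  neighbour down  a k = suc a , k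
  neighbour left  a k = a , suc k
  neighbour right a k = suc (suc a) , suc k

  adjacent⇒neighbour : ∀ {a k x w} → x IsAt (suc a , suc k) → WbAdj (suc n) (suc r₀) x w →
                       ∃[ d ] w IsAt neighbour d a k
  adjacent⇒neighbour (at-cyc _ refl) (path-edge _ _ j (inj₁ j≡j₀+1)) = up , at-cyc j (sym j≡j₀+1)
  adjacent⇒neighbour {a} (at-cyc _ refl) (path-edge _ _ j (inj₂ j₀≡j+1)) =
    down , subst (λ k → cyc (col (suc a)) j IsAt (suc a , k)) j₀≡j+1 (at-cyc j refl)
  adjacent⇒neighbour {a} (at-cyc j₀ refl) (cycle-edge _ _ _ adj) with cycAdj-col⁻ {a} adj
  ... | inj₁ refl = left , at-cyc j₀ refl
  ... | inj₂ refl = right , at-cyc j₀ refl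
  adjacent⇒neighbour {a} (at-cyc _ refl) (pend-in _ _ j₀≡0) =
    down , subst (λ k → pend (col (suc a)) IsAt (suc a , k)) (sym j₀≡0) at-pend

  neighbour⇒adjacent : ∀ {a k x w} d → x IsAt (suc a , suc k) → w IsAt neighbour d a k →
                       WbAdj (suc n) (suc r₀) x w
  neighbour⇒adjacent up (at-cyc j₀ refl) (at-cyc j j≡) = path-edge _ j₀ j (inj₁ (sym j≡))
  neighbour⇒adjacent {k = zero} down (at-cyc j₀ j₀≡0) at-pend = pend-in _ j₀ j₀≡0
  neighbour⇒adjacent {k = suc k} down (at-cyc j₀ j₀≡) (at-cyc j j≡) =
    path-edge _ j₀ j (inj₂ (trans (cong suc j≡) (sym j₀≡)))
  neighbour⇒adjacent {a} left (at-cyc j₀ j₀≡) (at-cyc j j≡)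
    with refl ← toℕ-injective (trans j≡ (sym j₀≡)) =
    cycle-edge _ _ j (cycAdj-sym (cycAdj-csuc (col a)))
  neighbour⇒adjacent {a} right (at-cyc j₀ j₀≡) (at-cyc j j≡)
    with refl ← toℕ-injective (trans j≡ (sym j₀≡)) =
    cycle-edge _ _ j (cycAdj-csuc (col (suc a)))

  force-toward : ∀ {a k} → k < r → BlueAt (suc a , suc k) → ∀ d →
                 (∀ d′ → d′ ≡ d ⊎ BlueAt (neighbour d′ a k)) → BlueAt (neighbour d a k)
  force-toward {a} {k} k<r blue d others {v} v-at =
    force (blue x-at) (neighbour⇒adjacent d x-at v-at) rest
    where
    x-at : cyc (col (suc a)) (fromℕ< k<r) IsAt (suc a , suc k)
    x-at = at-cyc (fromℕ< k<r) (toℕ-fromℕ< k<r)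
    rest : ∀ w → WbAdj (suc n) (suc r₀) (cyc (col (suc a)) (fromℕ< k<r)) w → w ≢ v → IsBlue w
    rest w x~w w≢v with adjacent⇒neighbour x-at x~w
    ... | d′ , w-at with others d′
    ...   | inj₁ refl = ⊥-elim (w≢v (isAt-unique w-at v-at))
    ...   | inj₂ blue′ = blue′ w-at

  module _ {a k} (k<r : k < r) (source : BlueAt (suc a , suc k)) where

    force-up : BlueAt (suc a , k) → BlueAt (a , suc k) → BlueAt (suc (suc a) , suc k) →
               BlueAt (suc a , suc (suc k))
    force-up below left′ right′ = force-toward k<r source up
      λ { up → inj₁ refl ; down → inj₂ below ; left → inj₂ left′ ; right → inj₂ right′ }

    force-down : BlueAt (suc a , suc (suc k)) → BlueAt (a , suc k) → BlueAt (suc (suc a) , suc k) →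
                 BlueAt (suc a , k)
    force-down above left′ right′ = force-toward k<r source down
      λ { up → inj₂ above ; down → inj₁ refl ; left → inj₂ left′ ; right → inj₂ right′ }

    force-left : BlueAt (suc a , suc (suc k)) → BlueAt (suc a , k) → BlueAt (suc (suc a) , suc k) →
                 BlueAt (a , suc k)
    force-left above below right′ = force-toward k<r source left
      λ { up → inj₂ above ; down → inj₂ below ; left → inj₁ refl ; right → inj₂ right′ }

    force-right : BlueAt (suc a , suc (suc k)) → BlueAt (suc a , k) → BlueAt (a , suc k) →
                  BlueAt (suc (suc a) , suc k)
    force-right above below left′ = force-toward k<r source right
      λ { up → inj₂ above ; down → inj₂ below ; left → inj₂ left′ ; right → inj₁ refl }

  pendant-forces : ∀ {a} → BlueAt (a , 0) → BlueAt (a , 1)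
  pendant-forces {a} blue (at-cyc j j≡0) = force (blue at-pend) (pend-out _ j j≡0) only-neighbour
    where
    only-neighbour : ∀ w → WbAdj (suc n) (suc r₀) (pend (col a)) w → w ≢ cyc (col a) j → IsBlue w
    only-neighbour _ (pend-out _ j′ j′≡0) w≢v =
      ⊥-elim (w≢v (cong (cyc (col a)) (toℕ-injective (trans j′≡0 (sym j≡0)))))

  Above : ℕ → ℕ → Set
  Above a ℓ = ∀ {k} → ℓ ≤ k → BlueAt (a , k)

  Full : ℕ → Set
  Full a = Above a 0

  above-suc : ∀ {a ℓ} → Above a ℓ → Above a (suc ℓ)
  above-suc above ℓ<k = above (<⇒≤ ℓ<k)

  full-cong : ∀ {a b} → col a ≡ col b → Full a → Full b
  full-cong eq full 0≤k = blueAt-cong eq (full 0≤k)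

  full-from-low : ∀ {a} → (∀ {k} → k ≤ r → BlueAt (a , k)) → Full a
  full-from-low {a} low {k} _ with k ≤? r
  ... | yes k≤r = low k≤r
  ... | no  k≰r = blueAt-beyond {a} (≰⇒> k≰r)

  full-from-pendant : ∀ {a} → BlueAt (a , 0) → Above a 1 → Full a
  full-from-pendant pendant _     {zero}  _ = pendant
  full-from-pendant _       above {suc k} _ = above (s≤s z≤n)

  sweep-right : ∀ {a ℓ} → Above a ℓ → Above (suc a) ℓ → Above (suc (suc a)) (suc ℓ)
  sweep-right ha hb {suc k} (s≤s ℓ≤k) w-at =
    force-right (level<r w-at) (hb (m≤n⇒m≤1+n ℓ≤k)) (hb (m≤n⇒m≤1+n (m≤n⇒m≤1+n ℓ≤k))) (hb ℓ≤k)
      (ha (m≤n⇒m≤1+n ℓ≤k)) w-at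

  sweep-left : ∀ {a ℓ} → Above (suc (suc a)) ℓ → Above (suc a) ℓ → Above a (suc ℓ)
  sweep-left hc hb {suc k} (s≤s ℓ≤k) w-at =
    force-left (level<r w-at) (hb (m≤n⇒m≤1+n ℓ≤k)) (hb (m≤n⇒m≤1+n (m≤n⇒m≤1+n ℓ≤k))) (hb ℓ≤k)
      (hc (m≤n⇒m≤1+n ℓ≤k)) w-at

  pendant-forced : ∀ {a} → BlueAt (a , 1) → Above (suc a) 1 → BlueAt (suc (suc a) , 1) →
                   BlueAt (suc a , 0)
  pendant-forced hl hb hr = force-down (s≤s z≤n) (hb (s≤s z≤n)) (hb (s≤s z≤n)) hl hr

  full-step-right : ∀ {a} → Full a → Full (suc a) → BlueAt (suc (suc a) , 0) → Full (suc (suc a))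
  full-step-right fa fb pendant = full-from-pendant pendant (sweep-right fa fb)

  full-step-left : ∀ {a} → Full (suc (suc a)) → Full (suc a) → BlueAt (a , 0) → Full a
  full-step-left fc fb pendant = full-from-pendant pendant (sweep-left fc fb)

  full-skip-right : ∀ {a} → Full a → Full (suc a) → BlueAt (3 + a , 0) → Full (2 + a) × Full (3 + a)
  full-skip-right {a} fa fb pendant = fc , full-step-right fb fc pendant
    where
    fc : Full (2 + a)
    fc = full-from-pendant (pendant-forced (fb z≤n) (sweep-right fa fb) (pendant-forces pendant))
                           (sweep-right fa fb)

  FullBelow : ℕ → Set
  FullBelow e = ∀ {t} → t < e → Full t

  fullBelow-extend : ∀ {e} → FullBelow e → Full e → FullBelow (suc e)
  fullBelow-extend below fe t<e+1 with m<1+n⇒m<n∨m≡n t<e+1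
  ... | inj₁ t<e  = below t<e
  ... | inj₂ refl = fe

  run-right : ∀ {c} t → FullBelow (2 + c) → (∀ {i} → i < t → BlueAt (2 + i + c , 0)) →
              FullBelow (2 + t + c)
  run-right zero    below _        = below
  run-right (suc t) below pendants =
    fullBelow-extend ih
      (full-step-right (ih (m<n⇒m<1+n (n<1+n _))) (ih (n<1+n _)) (pendants (n<1+n t)))
    where ih = run-right t below (λ i<t → pendants (m<n⇒m<1+n i<t))

  skip-run-right : ∀ {c} A → FullBelow (2 + c) → (∀ {u} → u < A → BlueAt (3 + u * 2 + c , 0)) →
                   FullBelow (2 + A * 2 + c)
  skip-run-right zero    below _        = below
  skip-run-right (suc A) below pendants =
    fullBelow-extend (fullBelow-extend ih (proj₁ next)) (proj₂ next)
    where
    ih = skip-run-right A below (λ u<A → pendants (m<n⇒m<1+n u<A))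
    next = full-skip-right (ih (m<n⇒m<1+n (n<1+n _))) (ih (n<1+n _)) (pendants (n<1+n A))

  run-left : ∀ {e} → Full e → Full (suc e) → (∀ {i} → i < e → BlueAt (i , 0)) → FullBelow (2 + e)
  run-left {e} fe fe′ pendants = below
    where
    pairs : ∀ d {c} → c + d ≡ e → Full c × Full (suc c)
    pairs zero    {c} eq with refl ← trans (sym (+-identityʳ c)) eq = fe , fe′
    pairs (suc d) {c} eq = full-step-left (proj₂ ih) (proj₁ ih) (pendants c<e) , proj₁ ih
      where
      ih  = pairs d {suc c} (trans (sym (+-suc c d)) eq)
      c<e = ≤-trans (s≤s (m≤m+n c d)) (≤-reflexive (trans (sym (+-suc c d)) eq))
    below : FullBelow (2 + e)
    below {zero}  _               = proj₁ (pairs e refl)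
    below {suc t} (s≤s (s≤s t≤e)) = proj₂ (pairs (e ∸ t) (m+[n∸m]≡n t≤e))

  stairs-right : ∀ {a ℓ} → Above a ℓ → Above (suc a) ℓ → ∀ x → Above (suc (x + a)) (x + ℓ)
  stairs-right {a} {ℓ} ha hb x = proj₂ (pairs x)
    where
    pairs : ∀ x → Above (x + a) (x + ℓ) × Above (suc (x + a)) (x + ℓ)
    pairs zero    = ha , hb
    pairs (suc x) = above-suc (proj₂ (pairs x)) , sweep-right (proj₁ (pairs x)) (proj₂ (pairs x))

  stairs-left : ∀ {c ℓ} → Above (suc c) ℓ → Above c ℓ → ∀ y {b} → y + b ≡ c → Above b (y + ℓ)
  stairs-left {c} {ℓ} hc′ hc y eq = proj₂ (pairs y eq)
    where
    pairs : ∀ y {b} → y + b ≡ c → Above (suc b) (y + ℓ) × Above b (y + ℓ)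
    pairs zero    refl = hc′ , hc
    pairs (suc y) {b} eq = above-suc (proj₂ ih) , sweep-left (proj₁ ih) (proj₂ ih)
      where ih = pairs y {suc b} (trans (+-suc y b) eq)

  -- Column suc (x + a) is reached at height x from the left and at height s − x from the
  -- right; as s ≤ 2r + 1, one of the two is at most r.
  gap-top : ∀ {a s} → Full a → Full (suc a) → Full (suc (s + a)) → Full (suc (suc (s + a))) →
            s ≤ suc (r + r) → ∀ {x} → x ≤ s → BlueAt (suc (x + a) , r)
  gap-top {a} {s} fa fa′ fb fb′ s≤2r+1 {x} x≤s with x ≤? r
  ... | yes x≤r = stairs-right fa fa′ x (≤-trans (≤-reflexive (+-identityʳ x)) x≤r)
  ... | no  x≰r = stairs-left fb′ fb y y+x+a≡s+a (≤-trans (≤-reflexive (+-identityʳ y)) y≤r)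
    where
    y = s ∸ x
    y+x+a≡s+a : y + suc (x + a) ≡ suc (s + a)
    y+x+a≡s+a = trans (+-suc y (x + a))
                  (cong suc (trans (sym (+-assoc y x a)) (cong (_+ a) (m∸n+n≡m x≤s))))
    y≤r : y ≤ r
    y≤r = +-cancelˡ-≤ r y r (≤-pred (≤-trans (+-monoˡ-≤ y (≰⇒> x≰r))
            (≤-trans (≤-reflexive (m+[n∸m]≡n x≤s)) s≤2r+1)))

  Row : ℕ → Set
  Row k = ∀ a → BlueAt (a , k)

  row-down : ∀ {k} → k < r → Row (suc k) → Row (2 + k) → Row k
  row-down {k} k<r row₁ row₂ a =
    blueAt-cong {suc (a + n)} col≡ (force-down k<r (row₁ _) (row₂ _) (row₁ _) (row₁ _))
    where
    col≡ : col (suc (a + n)) ≡ col a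
    col≡ = trans (cong col (sym (+-suc a n))) (col-periodic a)

  every-row : Row r → ∀ k → Row k
  every-row top k with k ≤? r
  ... | yes k≤r = proj₁ (rows (r ∸ k) (m∸n+n≡m k≤r))
    where
    rows : ∀ d {k} → d + k ≡ r → Row k × Row (suc k)
    rows zero    refl = top , λ a → blueAt-beyond {a} ≤-refl
    rows (suc d) {k} eq = row-down k<r (proj₁ ih) (proj₂ ih) , proj₁ ih
      where
      ih  = rows d {suc k} (trans (+-suc d k) eq)
      k<r = ≤-trans (s≤s (m≤n+m k d)) (≤-reflexive eq)
  ... | no  k≰r = λ a → blueAt-beyond {a} (≰⇒> k≰r)

  top-row : (∀ {a} → a < suc n → BlueAt (a , r)) → Row r
  top-row top a = blueAt-cong (col-toℕ (col a)) (top (toℕ<n (col a)))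

  all-blue : Row r → ∀ v → IsBlue v
  all-blue top (cyc c j) = every-row top (suc (toℕ j)) (toℕ c)
    (subst (λ c′ → cyc c′ j IsAt (toℕ c , suc (toℕ j))) (col-toℕ c) (at-cyc j refl))
  all-blue top (pend c)  = every-row top 0 (toℕ c)
    (subst (λ c′ → pend c′ IsAt (toℕ c , 0)) (col-toℕ c) at-pend)

  module _ {R} (pendants : ∀ {i} → i < R → BlueAt (i , 0)) where

    -- d is the distance from column c to the last seeded column R − 1.
    triangle : ∀ l c d → c + suc d ≡ R → l ≤ suc c → l ≤ suc d → BlueAt (c , l)
    triangle zero          c       d       eq _ _ =
      pendants (<-≤-trans (m<m+n c (s≤s z≤n)) (≤-reflexive eq))
    triangle (suc zero)    c       d       eq _ _ = pendant-forces (triangle zero c d eq z≤n z≤n)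
    triangle (suc (suc l)) zero    _       _  (s≤s ()) _
    triangle (suc (suc l)) (suc c) zero    _  _        (s≤s ())
    triangle (suc (suc l)) (suc c) (suc d) eq (s≤s l<c) (s≤s l<d) w-at =
      force-up (<-trans (n<1+n l) (level<r w-at))
        (triangle (suc l) (suc c) (suc d) eq (step l<c) (step l<d))
        (triangle l (suc c) (suc d) eq (step (<⇒≤ l<c)) (step (<⇒≤ l<d)))
        (triangle (suc l) c (suc (suc d)) (trans (+-suc c (suc (suc d))) eq) l<c (step (step l<d)))
        (triangle (suc l) (suc (suc c)) d (trans (sym (+-suc (suc c) (suc d))) eq)
                  (step (step l<c)) l<d)
        w-at
      where step = m≤n⇒m≤1+n

module Construction (r₀ A g : ℕ) (g≤2r : g ≤ suc r₀ + suc r₀) where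

  -- Columns 0 … Q + 1 carry the seed and columns Q + 2 … m − 1 form the gap.
  Q : ℕ
  Q = A * 2 + (r₀ + r₀)

  open CyclicSuccessor (suc (g + Q)) using (col; col-periodic)

  pendant : ℕ → WbV (2 + (g + Q)) (suc r₀)
  pendant a = pend (col a)

  alternating-column : ℕ → ℕ
  alternating-column u = 3 + u * 2 + (r₀ + r₀)

  block alternating seeds : List (WbV (2 + (g + Q)) (suc r₀))
  block       = applyUpTo pendant (2 + (r₀ + r₀))
  alternating = applyUpTo (pendant ∘ alternating-column) A
  seeds       = block ++ alternating

  open Forcing (suc (g + Q)) r₀ seeds

  block-pendant : ∀ {i} → i < 2 + (r₀ + r₀) → BlueAt (i , 0)
  block-pendant i<R at-pend = initial (∈-++⁺ˡ (∈-applyUpTo⁺ pendant i<R))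

  alternating-pendant : ∀ {u} → u < A → BlueAt (alternating-column u , 0)
  alternating-pendant u<A at-pend =
    initial (∈-++⁺ʳ block (∈-applyUpTo⁺ (pendant ∘ alternating-column) u<A))

  middle-left : Full r₀
  middle-left = full-from-low λ {k} k≤r →
    triangle block-pendant k r₀ (suc r₀) (trans (+-suc r₀ (suc r₀)) (cong suc (+-suc r₀ r₀)))
      k≤r (m≤n⇒m≤1+n k≤r)

  middle-right : Full (suc r₀)
  middle-right = full-from-low λ {k} k≤r →
    triangle block-pendant k (suc r₀) r₀ (cong suc (+-suc r₀ r₀)) (m≤n⇒m≤1+n k≤r) k≤r

  prefix : FullBelow (2 + Q)
  prefix = skip-run-right A
             (run-right r₀ (run-left middle-left middle-right left-pendant) right-pendant)
             alternating-pendant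
    where
    left-pendant : ∀ {i} → i < r₀ → BlueAt (i , 0)
    left-pendant i<r₀ = block-pendant (<-trans i<r₀ (s≤s (m≤n⇒m≤1+n (m≤m+n r₀ r₀))))
    right-pendant : ∀ {i} → i < r₀ → BlueAt (2 + i + r₀ , 0)
    right-pendant i<r₀ = block-pendant (s≤s (s≤s (+-monoˡ-< r₀ i<r₀)))

  column-top : ∀ {t} → t < 2 + (g + Q) → BlueAt (t , r)
  column-top {t} t<m with t ≤? Q
  ... | yes t≤Q = prefix (s≤s (m≤n⇒m≤1+n t≤Q)) z≤n
  ... | no  t≰Q = subst (λ t → BlueAt (t , r)) x+Q+1≡t
                    (gap-top (prefix (m<n⇒m<1+n (n<1+n Q))) (prefix (n<1+n (suc Q)))
                             (full-cong (sym (col-periodic 0)) (prefix (s≤s z≤n)))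
                             (full-cong (sym (col-periodic 1)) (prefix (s≤s (s≤s z≤n))))
                             (s≤s g≤2r) x≤1+g)
    where
    x = t ∸ suc Q
    x+Q+1≡t : suc (x + Q) ≡ t
    x+Q+1≡t = trans (sym (+-suc x Q)) (m∸n+n≡m (≰⇒> t≰Q))
    x≤1+g : x ≤ suc g
    x≤1+g = m≤n⇒m≤1+n (≤-trans (∸-monoˡ-≤ (suc Q) (≤-pred t<m)) (≤-reflexive (m+n∸n≡m g Q)))

  seeds-length : length seeds ≡ 2 + (r₀ + r₀) + A
  seeds-length =
    trans (length-++ block) (cong₂ _+_ (length-applyUpTo pendant _) (length-applyUpTo _ A))

  zero-forcing : Z≤ (Wb (2 + (g + Q)) (suc r₀)) (2 + (r₀ + r₀) + A)
  zero-forcing =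
    Z≤-from-forcing-list _≟ᵂ_ (all-blue (top-row column-top)) (≤-reflexive seeds-length)

layout : ∀ m r₀ → 2 * suc r₀ ≤ ⌈ m /2⌉ →
         ∃[ A ] ∃[ g ] g ≤ suc r₀ + suc r₀ ×
                       2 + (g + (A * 2 + (r₀ + r₀))) ≡ m × 2 + (r₀ + r₀) + A ≡ ⌈ m /2⌉
-- The gap g = m − 2⌈m/2⌉ + 2r is at most 2r because m ≤ 2⌈m/2⌉.
layout m r₀ 2r≤K = A , m ∸ B , g≤2r , m≡ , R+A≡K
  where
  K = ⌈ m /2⌉
  R = 2 + (r₀ + r₀)
  A = K ∸ R
  B = 2 + (A * 2 + (r₀ + r₀))
  R+A≡K : R + A ≡ K
  R+A≡K = m+[n∸m]≡n (subst (_≤ K) (two-r r₀) 2r≤K)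
    where
    two-r : ∀ r₀ → 2 * suc r₀ ≡ 2 + (r₀ + r₀)
    two-r = solve-∀
  B+R≡K+K : B + R ≡ K + K
  B+R≡K+K = trans (regroup r₀ A) (cong₂ _+_ R+A≡K R+A≡K)
    where
    regroup : ∀ r₀ A → 2 + (A * 2 + (r₀ + r₀)) + (2 + (r₀ + r₀)) ≡
                       (2 + (r₀ + r₀) + A) + (2 + (r₀ + r₀) + A)
    regroup = solve-∀
  K+K≤1+m : K + K ≤ suc m
  K+K≤1+m = ≤-trans (+-monoʳ-≤ K (⌊n/2⌋≤⌈n/2⌉ (suc m))) (≤-reflexive (⌊n/2⌋+⌈n/2⌉≡n (suc m)))
  m≤K+K : m ≤ K + K
  m≤K+K = ≤-trans (≤-reflexive (sym (⌊n/2⌋+⌈n/2⌉≡n m))) (+-monoˡ-≤ K (⌊n/2⌋≤⌈n/2⌉ m))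
  B≤m : B ≤ m
  B≤m = m+n≤o⇒m≤o B (≤-pred (≤-trans (≤-reflexive (sym (+-suc B (suc (r₀ + r₀)))))
                                      (≤-trans (≤-reflexive B+R≡K+K) K+K≤1+m)))
  g≤2r : m ∸ B ≤ suc r₀ + suc r₀
  g≤2r = subst (m ∸ B ≤_) (cong suc (sym (+-suc r₀ r₀)))
           (m≤n+o⇒m∸n≤o m B (≤-trans m≤K+K (≤-reflexive (sym B+R≡K+K))))
  m≡ : 2 + (m ∸ B + (A * 2 + (r₀ + r₀))) ≡ m
  m≡ = trans (sym (trans (+-suc (m ∸ B) (suc (A * 2 + (r₀ + r₀)))) (cong suc (+-suc (m ∸ B) _))))
             (m∸n+n≡m B≤m)

mainTheorem7 : (m r : ℕ) → 3 ≤ m → 1 ≤ r → 2 * r ≤ ⌈ m /2⌉ →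
    Z≤ (Wb m r) ⌈ m /2⌉
mainTheorem7 _ zero    _ () _
mainTheorem7 m (suc r₀) _ _ 2r≤K with layout m r₀ 2r≤K
... | A , g , g≤2r , m≡ , size≡ =
  subst₂ (λ m k → Z≤ (Wb m (suc r₀)) k) m≡ size≡ (Construction.zero-forcing r₀ A g g≤2r)
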